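{- Let $d\geq2$, let $\alpha_1,\dots,\alpha_d\in\mathbb Z$ with $\alpha_d\neq0$, and let $s\in\mathbb Z^{\mathbb N}$ satisfy $s(n+d)+\alpha_1s(n+d-1)+\dots+\alpha_ds(n)=0$ for all $n\geq0$. Let $c$ be a positive integer with $|s(n)|<c^{n+1}$ for all $n\in\mathbb N$, and put $u(n)=s(n)+c^{n+1}$. Let $$B(X)=(X-c)\left(X^d+\alpha_1X^{d-1}+\dots+\alpha_{d-1}X+\alpha_d\right)=X^{d+1}+\gamma_1X^d+\dots+\gamma_{d+1}$$ be the polynomial associated to the recurrence $u(n+d+1)+\gamma_1u(n+d)+\dots+\gamma_{d+1}u(n)=0$ satisfied by $u$, let $U_d(X)=u(d)+u(d-1)X+\dots+u(0)X^d$, and let $A(X)$ be the quotient of $B(X)U_d(X)$ upon division by $X^{d+1}$ (i.e. $B(X)U_d(X)=C(X)+X^{d+1}A(X)$ with $\deg C<d+1$). Then there is $n_0$ such that for every sufficiently large $b\in\mathbb N$, $$s(n)=\left\lfloor\frac{\left(b^{n(d-1)+\lceil n/2\rceil}+b^{n^2}A(b^n)\right)\bmod B(b^n)}{b^{nd}}\right\rfloor-c^{n+1}\quad\text{for all } n\geq n_0.$$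
   Context: $\mathbb N=\{0,1,2,\dots\}$. For integers $x$ and $y\neq0$, $x\bmod y$ denotes the unique integer $m$ with $0\leq m<|y|$ and $y\mid x-m$ (so it is nonnegative even when $x$ is negative), and $\lfloor\cdot\rfloor$ is the floor function. -}

module Defs where

open import Data.Nat as ℕ using (ℕ; zero; suc; ⌈_/2⌉)
open import Data.Integer.Base using (ℤ; +_; 0ℤ; 1ℤ; _+_; _*_; -_; ∣_∣; _%ℕ_)
open import Data.List.Base using (List; []; _∷_; map; drop; upTo)

sum1 : ℕ → (ℕ → ℤ) → ℤ
sum1 zero    f = 0ℤ
sum1 (suc n) f = sum1 n f + f (suc n)

-- Polynomials over ℤ as coefficient lists, lowest degree first.
Poly : Set
Poly = List ℤ

_+ₚ_ : Poly → Poly → Poly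
[]      +ₚ q       = q
(a ∷ p) +ₚ []      = a ∷ p
(a ∷ p) +ₚ (b ∷ q) = (a + b) ∷ (p +ₚ q)

scaleₚ : ℤ → Poly → Poly
scaleₚ a = map (a *_)

_*ₚ_ : Poly → Poly → Poly
[]      *ₚ q = []
(a ∷ p) *ₚ q = scaleₚ a q +ₚ (0ℤ ∷ (p *ₚ q))

evalₚ : Poly → ℤ → ℤ
evalₚ []      x = 0ℤ
evalₚ (a ∷ p) x = a + x * evalₚ p x

α' : (ℕ → ℤ) → ℕ → ℤ
α' α zero    = 1ℤ
α' α (suc i) = α (suc i)

-- X^d + α₁X^{d-1} + … + α_d  (coefficient of X^k is α_{d-k})
charPoly : ℕ → (ℕ → ℤ) → Poly
charPoly d α = map (λ k → α' α (d ℕ.∸ k)) (upTo (suc d))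

polyB : ℕ → (ℕ → ℤ) → ℕ → Poly
polyB d α c = ((- (+ c)) ∷ 1ℤ ∷ []) *ₚ charPoly d α

polyU : ℕ → (ℕ → ℤ) → Poly
polyU d u = map (λ k → u (d ℕ.∸ k)) (upTo (suc d))

polyA : ℕ → (ℕ → ℤ) → ℕ → (ℕ → ℤ) → Poly
polyA d α c u = drop (suc d) (polyB d α c *ₚ polyU d u)

-- x mod y (nonnegative, 0 ≤ m < |y|); the value for y = 0 is a dummy
-- and is never used (the theorem asserts y ≠ 0 where it is applied).
_modℤ_ : ℤ → ℤ → ℕ
x modℤ y with ∣ y ∣
... | zero  = 0
... | suc k = x %ℕ suc k

-- ⌊m / n⌋ for naturals; dummy value 0 for n = 0 (never used: n = b^{nd}, b ≥ 1)
_divℕ_ : ℕ → ℕ → ℕ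
m divℕ zero  = 0
m divℕ suc k = m ℕ./ suc k

-- Let B(X) = (X - c)(X^d + α₁ X^(d-1) + … + α_d), and let a polynomial p act on sequences as
-- p(S) for the shift S f = f ∘ suc; then B(S) annihilates u = s + c^(·+1). Consequently
-- A(X) / B(X) = ∑_{m ≥ 0} u(m) X^(-m-1), and Y^n A(Y) ≡ R_n(Y) (mod B(Y)), where R_n(X) is the
-- polynomial part of B(X) ∑_{m ≥ 0} u(n + m) X^(-m-1). R_n(X) = u(n) X^d + (terms of lower degree
-- with coefficients O(c^n)). For Y = b^n, adding Y^(d-1) b^⌈n/2⌉ to Y^n A(Y) moves R_n(Y) into
-- [u(n) Y^d, (u(n) + 1) Y^d), which lies in [0, B(Y)) because 0 ≤ u(n) < 2 c^(n+1) is tiny against Y.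
-- So this is the residue modulo B(Y), and its quotient by Y^d = b^(nd) is u(n) = s(n) + c^(n+1).

{-# OPTIONS --safe #-}
module Submission where

open import Defs
open import Data.Nat using (ℕ; suc; _≤_; _<_; _^_; _∸_; ⌈_/2⌉) renaming (_*_ to _*ℕ_; _+_ to _+ℕ_)
open import Data.Integer.Base using (ℤ; +_; 0ℤ; _+_; _*_; _-_; ∣_∣)
open import Data.Product using (Σ; _×_)
open import Relation.Binary.PropositionalEquality using (_≡_; _≢_)

open import Data.Nat.Base using (zero; z≤n; s≤s; _⊔_; >-nonZero; ⌊_/2⌋)
import Data.Nat.Properties as ℕ
import Data.Nat.DivMod as ℕ
-- _+ℤ_ is _+_ again, for sections (x +ℤ_): (x +_) would clash with the constructor +_.
open import Data.Integer.Base using (1ℤ; -_; -[1+_]) renaming (_^_ to _^ℤ_; _+_ to _+ℤ_)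
import Data.Integer.Properties as ℤ
import Data.Integer.DivMod as ℤ
open import Data.Integer.Tactic.RingSolver using (solve-∀)
import Data.Nat.Tactic.RingSolver as ℕ-Solver
open import Data.List.Base using ([]; _∷_; drop; take; length; applyUpTo)
import Data.List.Properties as List
open import Data.List.Relation.Unary.All as All using (All; []; _∷_)
import Data.List.Relation.Unary.All.Properties as All
open import Data.Product using (_,_; proj₁; proj₂)
open import Relation.Binary.PropositionalEquality using (refl; sym; trans; cong; cong₂; subst; subst₂; module ≡-Reasoning)
open import Data.Empty using (⊥-elim)

-- Finite sums

∑ : ℕ → (ℕ → ℤ) → ℤ
∑ zero    f = 0ℤ
∑ (suc N) f = f 0 + ∑ N (λ i → f (suc i))

∑-cong : ∀ N {f g : ℕ → ℤ} → (∀ i → i < N → f i ≡ g i) → ∑ N f ≡ ∑ N g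
∑-cong zero    eq = refl
∑-cong (suc N) eq = cong₂ _+_ (eq 0 (s≤s z≤n)) (∑-cong N (λ i i<N → eq (suc i) (s≤s i<N)))

∑-zero : ∀ N → ∑ N (λ _ → 0ℤ) ≡ 0ℤ
∑-zero zero    = refl
∑-zero (suc N) = trans (ℤ.+-identityˡ _) (∑-zero N)

∑-snoc : ∀ N f → ∑ (suc N) f ≡ ∑ N f + f N
∑-snoc zero    f = trans (ℤ.+-identityʳ (f 0)) (sym (ℤ.+-identityˡ (f 0)))
∑-snoc (suc N) f = trans (cong (f 0 +ℤ_) (∑-snoc N (λ i → f (suc i)))) (sym (ℤ.+-assoc (f 0) _ _))

∑-reverse : ∀ N f → ∑ (suc N) (λ i → f (N ∸ i)) ≡ ∑ (suc N) f
∑-reverse zero    f = refl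
∑-reverse (suc N) f = begin
  f (suc N) + ∑ (suc N) (λ i → f (N ∸ i))  ≡⟨ cong (f (suc N) +ℤ_) (∑-reverse N f) ⟩
  f (suc N) + ∑ (suc N) f                   ≡⟨ ℤ.+-comm (f (suc N)) _ ⟩
  ∑ (suc N) f + f (suc N)                   ≡⟨ sym (∑-snoc (suc N) f) ⟩
  ∑ (suc (suc N)) f                         ∎
  where open ≡-Reasoning

sum1≡∑ : ∀ N f → sum1 N f ≡ ∑ N (λ i → f (suc i))
sum1≡∑ zero    f = refl
sum1≡∑ (suc N) f = trans (cong (_+ f (suc N)) (sum1≡∑ N f)) (sym (∑-snoc N (λ i → f (suc i))))

-- Coefficients and evaluation

coeff : Poly → ℕ → ℤ
coeff []      i       = 0ℤ
coeff (a ∷ p) zero    = a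
coeff (a ∷ p) (suc i) = coeff p i

infix 4 _≈ₚ_
_≈ₚ_ : Poly → Poly → Set
p ≈ₚ q = ∀ i → coeff p i ≡ coeff q i

coeff-+ₚ : ∀ p q i → coeff (p +ₚ q) i ≡ coeff p i + coeff q i
coeff-+ₚ []      q       i       = sym (ℤ.+-identityˡ _)
coeff-+ₚ (a ∷ p) []      i       = sym (ℤ.+-identityʳ _)
coeff-+ₚ (a ∷ p) (b ∷ q) zero    = refl
coeff-+ₚ (a ∷ p) (b ∷ q) (suc i) = coeff-+ₚ p q i

coeff-scaleₚ : ∀ a p i → coeff (scaleₚ a p) i ≡ a * coeff p i
coeff-scaleₚ a []      i       = sym (ℤ.*-zeroʳ a)
coeff-scaleₚ a (b ∷ p) zero    = refl
coeff-scaleₚ a (b ∷ p) (suc i) = coeff-scaleₚ a p i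

coeff-drop : ∀ k p i → coeff (drop k p) i ≡ coeff p (k +ℕ i)
coeff-drop zero    p       i = refl
coeff-drop (suc k) []      i = refl
coeff-drop (suc k) (a ∷ p) i = coeff-drop k p i

coeff-*ₚ-∷ˡ : ∀ a p q i → coeff ((a ∷ p) *ₚ q) (suc i) ≡ a * coeff q (suc i) + coeff (p *ₚ q) i
coeff-*ₚ-∷ˡ a p q i = trans (coeff-+ₚ (scaleₚ a q) (0ℤ ∷ p *ₚ q) (suc i))
                            (cong (_+ coeff (p *ₚ q) i) (coeff-scaleₚ a q (suc i)))

*ₚ-identityˡ : ∀ q → (1ℤ ∷ []) *ₚ q ≈ₚ q
*ₚ-identityˡ q i = begin
  coeff (scaleₚ 1ℤ q +ₚ (0ℤ ∷ [])) i  ≡⟨ coeff-+ₚ (scaleₚ 1ℤ q) (0ℤ ∷ []) i ⟩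
  coeff (scaleₚ 1ℤ q) i + coeff (0ℤ ∷ []) i  ≡⟨ cong₂ _+_ (coeff-scaleₚ 1ℤ q i) (singleton-zero i) ⟩
  1ℤ * coeff q i + 0ℤ                  ≡⟨ trans (ℤ.+-identityʳ _) (ℤ.*-identityˡ _) ⟩
  coeff q i                            ∎
  where
  open ≡-Reasoning
  singleton-zero : ∀ i → coeff (0ℤ ∷ []) i ≡ 0ℤ
  singleton-zero zero    = refl
  singleton-zero (suc i) = refl

*ₚ-zeroʳ : ∀ p → p *ₚ [] ≈ₚ []
*ₚ-zeroʳ []      i       = refl
*ₚ-zeroʳ (a ∷ p) zero    = refl
*ₚ-zeroʳ (a ∷ p) (suc i) = *ₚ-zeroʳ p i

coeff-*ₚ-∷ʳ : ∀ p b q i → coeff (p *ₚ (b ∷ q)) i ≡ b * coeff p i + coeff (0ℤ ∷ p *ₚ q) i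
coeff-*ₚ-∷ʳ []      b q zero    = sym (trans (ℤ.+-identityʳ (b * 0ℤ)) (ℤ.*-zeroʳ b))
coeff-*ₚ-∷ʳ []      b q (suc i) = sym (trans (ℤ.+-identityʳ (b * 0ℤ)) (ℤ.*-zeroʳ b))
coeff-*ₚ-∷ʳ (a ∷ p) b q zero    = cong (_+ 0ℤ) (ℤ.*-comm a b)
coeff-*ₚ-∷ʳ (a ∷ p) b q (suc i) = begin
  coeff (scaleₚ a q +ₚ (p *ₚ (b ∷ q))) i
    ≡⟨ coeff-+ₚ (scaleₚ a q) (p *ₚ (b ∷ q)) i ⟩
  coeff (scaleₚ a q) i + coeff (p *ₚ (b ∷ q)) i
    ≡⟨ cong (coeff (scaleₚ a q) i +ℤ_) (coeff-*ₚ-∷ʳ p b q i) ⟩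
  coeff (scaleₚ a q) i + (b * coeff p i + coeff (0ℤ ∷ p *ₚ q) i)
    ≡⟨ swap (coeff (scaleₚ a q) i) (b * coeff p i) _ ⟩
  b * coeff p i + (coeff (scaleₚ a q) i + coeff (0ℤ ∷ p *ₚ q) i)
    ≡⟨ cong (b * coeff p i +ℤ_) (sym (coeff-+ₚ (scaleₚ a q) (0ℤ ∷ p *ₚ q) i)) ⟩
  b * coeff p i + coeff ((a ∷ p) *ₚ q) i
    ∎
  where
  open ≡-Reasoning
  swap : ∀ x y z → x + (y + z) ≡ y + (x + z)
  swap = solve-∀

evalₚ-≈[] : ∀ {p} y → p ≈ₚ [] → evalₚ p y ≡ 0ℤ
evalₚ-≈[] {[]}    y eq = refl
evalₚ-≈[] {a ∷ p} y eq = begin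
  a + y * evalₚ p y  ≡⟨ cong₂ (λ a e → a + y * e) (eq 0) (evalₚ-≈[] {p} y (λ i → eq (suc i))) ⟩
  0ℤ + y * 0ℤ        ≡⟨ trans (ℤ.+-identityˡ _) (ℤ.*-zeroʳ y) ⟩
  0ℤ                 ∎
  where open ≡-Reasoning

evalₚ-cong : ∀ {p q} y → p ≈ₚ q → evalₚ p y ≡ evalₚ q y
evalₚ-cong {[]}    {q}     y eq = sym (evalₚ-≈[] {q} y (λ i → sym (eq i)))
evalₚ-cong {a ∷ p} {[]}    y eq = evalₚ-≈[] {a ∷ p} y eq
evalₚ-cong {a ∷ p} {b ∷ q} y eq = cong₂ (λ a e → a + y * e) (eq 0) (evalₚ-cong {p} {q} y (λ i → eq (suc i)))

evalₚ-take-drop : ∀ N p y → evalₚ p y ≡ evalₚ (take N p) y + y ^ℤ N * evalₚ (drop N p) y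
evalₚ-take-drop zero    p       y = sym (trans (ℤ.+-identityˡ _) (ℤ.*-identityˡ _))
evalₚ-take-drop (suc N) []      y = sym (trans (ℤ.+-identityˡ _) (ℤ.*-zeroʳ (y ^ℤ suc N)))
evalₚ-take-drop (suc N) (a ∷ p) y = begin
  a + y * evalₚ p y
    ≡⟨ cong (λ e → a + y * e) (evalₚ-take-drop N p y) ⟩
  a + y * (evalₚ (take N p) y + y ^ℤ N * evalₚ (drop N p) y)
    ≡⟨ regroup a y (evalₚ (take N p) y) (y ^ℤ N) (evalₚ (drop N p) y) ⟩
  (a + y * evalₚ (take N p) y) + y * y ^ℤ N * evalₚ (drop N p) y
    ∎
  where
  open ≡-Reasoning
  regroup : ∀ a y t z e → a + y * (t + z * e) ≡ (a + y * t) + y * z * e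
  regroup = solve-∀

evalₚ-top : ∀ N {p a} y → drop N p ≈ₚ a ∷ [] → evalₚ p y ≡ evalₚ (take N p) y + y ^ℤ N * a
evalₚ-top N {p} {a} y top = begin
  evalₚ p y                                          ≡⟨ evalₚ-take-drop N p y ⟩
  evalₚ (take N p) y + y ^ℤ N * evalₚ (drop N p) y  ≡⟨ cong high (evalₚ-cong {drop N p} y top) ⟩
  evalₚ (take N p) y + y ^ℤ N * (a + y * 0ℤ)        ≡⟨ cong high (trans (cong (a +ℤ_) (ℤ.*-zeroʳ y)) (ℤ.+-identityʳ a)) ⟩
  evalₚ (take N p) y + y ^ℤ N * a                   ∎
  where
  open ≡-Reasoning
  high : ℤ → ℤ
  high e = evalₚ (take N p) y + y ^ℤ N * e

Monic : ℕ → Poly → Set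
Monic N p = drop N p ≈ₚ 1ℤ ∷ []

monic-degree : ∀ N {p} → Monic N p → drop (suc N) p ≈ₚ []
monic-degree N {p} monic i = begin
  coeff (drop (suc N) p) i  ≡⟨ coeff-drop (suc N) p i ⟩
  coeff p (suc N +ℕ i)      ≡⟨ cong (coeff p) (sym (ℕ.+-suc N i)) ⟩
  coeff p (N +ℕ suc i)      ≡⟨ sym (coeff-drop N p (suc i)) ⟩
  coeff (drop N p) (suc i)  ≡⟨ monic (suc i) ⟩
  0ℤ                        ∎
  where open ≡-Reasoning

evalₚ-monic : ∀ N {p} y → Monic N p → evalₚ p y ≡ evalₚ (take N p) y + y ^ℤ N
evalₚ-monic N {p} y monic = trans (evalₚ-top N y monic) (cong (evalₚ (take N p) y +ℤ_) (ℤ.*-identityʳ _))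

-- Polynomials acting on sequences

-- applyₚ p f = p(S) f.
applyₚ : Poly → (ℕ → ℤ) → ℕ → ℤ
applyₚ []      f n = 0ℤ
applyₚ (a ∷ p) f n = a * f n + applyₚ p f (suc n)

applyₚ-≈[] : ∀ {p} f n → p ≈ₚ [] → applyₚ p f n ≡ 0ℤ
applyₚ-≈[] {[]}    f n eq = refl
applyₚ-≈[] {a ∷ p} f n eq = begin
  a * f n + applyₚ p f (suc n)  ≡⟨ cong₂ (λ a r → a * f n + r) (eq 0) (applyₚ-≈[] {p} f (suc n) (λ i → eq (suc i))) ⟩
  0ℤ * f n + 0ℤ                 ≡⟨⟩
  0ℤ                            ∎
  where open ≡-Reasoning

applyₚ-cong : ∀ {p q} f n → p ≈ₚ q → applyₚ p f n ≡ applyₚ q f n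
applyₚ-cong {[]}    {q}     f n eq = sym (applyₚ-≈[] {q} f n (λ i → sym (eq i)))
applyₚ-cong {a ∷ p} {[]}    f n eq = applyₚ-≈[] {a ∷ p} f n eq
applyₚ-cong {a ∷ p} {b ∷ q} f n eq =
  cong₂ (λ a r → a * f n + r) (eq 0) (applyₚ-cong {p} {q} f (suc n) (λ i → eq (suc i)))

applyₚ-∑ : ∀ N q f n → drop N q ≈ₚ [] → applyₚ q f n ≡ ∑ N (λ t → coeff q t * f (t +ℕ n))
applyₚ-∑ zero    q       f n deg = applyₚ-≈[] {q} f n deg
applyₚ-∑ (suc N) []      f n deg = sym (∑-zero (suc N))
applyₚ-∑ (suc N) (a ∷ q) f n deg = cong (a * f n +ℤ_) (trans (applyₚ-∑ N q f (suc n) deg)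
  (∑-cong N (λ t _ → cong (λ m → coeff q t * f m) (ℕ.+-suc t n))))

applyₚ-+ : ∀ p f g n → applyₚ p (λ m → f m + g m) n ≡ applyₚ p f n + applyₚ p g n
applyₚ-+ []      f g n = refl
applyₚ-+ (a ∷ p) f g n = begin
  a * (f n + g n) + applyₚ p (λ m → f m + g m) (suc n)
    ≡⟨ cong (a * (f n + g n) +ℤ_) (applyₚ-+ p f g (suc n)) ⟩
  a * (f n + g n) + (applyₚ p f (suc n) + applyₚ p g (suc n))
    ≡⟨ distrib a (f n) (g n) _ _ ⟩
  (a * f n + applyₚ p f (suc n)) + (a * g n + applyₚ p g (suc n))
    ∎
  where
  open ≡-Reasoning
  distrib : ∀ a x y r s → a * (x + y) + (r + s) ≡ (a * x + r) + (a * y + s)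
  distrib = solve-∀

applyₚ-+ₚ : ∀ p q f n → applyₚ (p +ₚ q) f n ≡ applyₚ p f n + applyₚ q f n
applyₚ-+ₚ []      q       f n = sym (ℤ.+-identityˡ _)
applyₚ-+ₚ (a ∷ p) []      f n = sym (ℤ.+-identityʳ _)
applyₚ-+ₚ (a ∷ p) (b ∷ q) f n = begin
  (a + b) * f n + applyₚ (p +ₚ q) f (suc n)
    ≡⟨ cong ((a + b) * f n +ℤ_) (applyₚ-+ₚ p q f (suc n)) ⟩
  (a + b) * f n + (applyₚ p f (suc n) + applyₚ q f (suc n))
    ≡⟨ distrib a b (f n) _ _ ⟩
  (a * f n + applyₚ p f (suc n)) + (b * f n + applyₚ q f (suc n))
    ∎
  where
  open ≡-Reasoning
  distrib : ∀ a b x r s → (a + b) * x + (r + s) ≡ (a * x + r) + (b * x + s)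
  distrib = solve-∀

applyₚ-scaleₚ : ∀ a p f n → applyₚ (scaleₚ a p) f n ≡ a * applyₚ p f n
applyₚ-scaleₚ a []      f n = sym (ℤ.*-zeroʳ a)
applyₚ-scaleₚ a (b ∷ p) f n = begin
  a * b * f n + applyₚ (scaleₚ a p) f (suc n)  ≡⟨ cong (a * b * f n +ℤ_) (applyₚ-scaleₚ a p f (suc n)) ⟩
  a * b * f n + a * applyₚ p f (suc n)         ≡⟨ distrib a b (f n) _ ⟩
  a * (b * f n + applyₚ p f (suc n))           ∎
  where
  open ≡-Reasoning
  distrib : ∀ a b x r → a * b * x + a * r ≡ a * (b * x + r)
  distrib = solve-∀

applyₚ-*ₚ : ∀ p q f n → applyₚ (p *ₚ q) f n ≡ applyₚ p (applyₚ q f) n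
applyₚ-*ₚ []      q f n = refl
applyₚ-*ₚ (a ∷ p) q f n = begin
  applyₚ (scaleₚ a q +ₚ (0ℤ ∷ p *ₚ q)) f n
    ≡⟨ applyₚ-+ₚ (scaleₚ a q) (0ℤ ∷ p *ₚ q) f n ⟩
  applyₚ (scaleₚ a q) f n + (0ℤ * f n + applyₚ (p *ₚ q) f (suc n))
    ≡⟨ cong₂ (λ x y → x + (0ℤ * f n + y)) (applyₚ-scaleₚ a q f n) (applyₚ-*ₚ p q f (suc n)) ⟩
  a * applyₚ q f n + (0ℤ + applyₚ p (applyₚ q f) (suc n))
    ≡⟨ cong (a * applyₚ q f n +ℤ_) (ℤ.+-identityˡ _) ⟩
  a * applyₚ q f n + applyₚ p (applyₚ q f) (suc n)
    ∎
  where open ≡-Reasoning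

applyₚ-zero : ∀ p {f} n → (∀ m → f m ≡ 0ℤ) → applyₚ p f n ≡ 0ℤ
applyₚ-zero []      n f≡0 = refl
applyₚ-zero (a ∷ p) n f≡0 = trans (cong₂ (λ x r → a * x + r) (f≡0 n) (applyₚ-zero p (suc n) f≡0))
                                  (trans (ℤ.+-identityʳ _) (ℤ.*-zeroʳ a))

applyₚ-geometric : ∀ p {f} r → (∀ m → f (suc m) ≡ r * f m) → ∀ n → applyₚ p f (suc n) ≡ r * applyₚ p f n
applyₚ-geometric []      r step n = sym (ℤ.*-zeroʳ r)
applyₚ-geometric (a ∷ p) {f} r step n = begin
  a * f (suc n) + applyₚ p f (suc (suc n))  ≡⟨ cong₂ (λ x y → a * x + y) (step n) (applyₚ-geometric p r step (suc n)) ⟩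
  a * (r * f n) + r * applyₚ p f (suc n)    ≡⟨ distrib a r (f n) _ ⟩
  r * (a * f n + applyₚ p f (suc n))        ∎
  where
  open ≡-Reasoning
  distrib : ∀ a r x y → a * (r * x) + r * y ≡ r * (a * x + y)
  distrib = solve-∀

Annihilates : Poly → (ℕ → ℤ) → Set
Annihilates p f = ∀ n → applyₚ p f n ≡ 0ℤ

annihilates-+ : ∀ p {f g} → Annihilates p f → Annihilates p g → Annihilates p (λ m → f m + g m)
annihilates-+ p {f} {g} ann-f ann-g n = trans (applyₚ-+ p f g n) (cong₂ _+_ (ann-f n) (ann-g n))

annihilates-*ₚ : ∀ p {q f} → Annihilates q f → Annihilates (p *ₚ q) f
annihilates-*ₚ p {q} {f} ann n = trans (applyₚ-*ₚ p q f n) (applyₚ-zero p n ann)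

linear-annihilates-geometric : ∀ r {f} → (∀ m → f (suc m) ≡ r * f m) → Annihilates (- r ∷ 1ℤ ∷ []) f
linear-annihilates-geometric r {f} step n = begin
  - r * f n + (1ℤ * f (suc n) + 0ℤ)  ≡⟨ cong (λ x → - r * f n + (1ℤ * x + 0ℤ)) (step n) ⟩
  - r * f n + (1ℤ * (r * f n) + 0ℤ)  ≡⟨ cancel r (f n) ⟩
  0ℤ                                 ∎
  where
  open ≡-Reasoning
  cancel : ∀ r x → - r * x + (1ℤ * (r * x) + 0ℤ) ≡ 0ℤ
  cancel = solve-∀

-- remₚ p f n is the polynomial part of p(X) · ∑_{m ≥ 0} f (n + m) X^(-m-1).
remₚ : Poly → (ℕ → ℤ) → ℕ → Poly
remₚ []      f n = []
remₚ (a ∷ p) f n = applyₚ p f n ∷ remₚ p f n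

coeff-remₚ : ∀ p f n i → coeff (remₚ p f n) i ≡ applyₚ (drop (suc i) p) f n
coeff-remₚ []      f n i       = refl
coeff-remₚ (a ∷ p) f n zero    = refl
coeff-remₚ (a ∷ p) f n (suc i) = coeff-remₚ p f n i

remₚ-step : ∀ p f n y →
  y * evalₚ (remₚ p f n) y + applyₚ p f n ≡ f n * evalₚ p y + evalₚ (remₚ p f (suc n)) y
remₚ-step []      f n y = trans (ℤ.+-identityʳ _) (trans (ℤ.*-zeroʳ y)
                                  (sym (trans (ℤ.+-identityʳ _) (ℤ.*-zeroʳ (f n)))))
remₚ-step (a ∷ p) f n y = begin
  y * (A + y * R) + (a * f n + A′)      ≡⟨ regroup y A R a (f n) A′ ⟩
  y * (y * R + A) + (a * f n + A′)      ≡⟨ cong (λ t → y * t + (a * f n + A′)) (remₚ-step p f n y) ⟩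
  y * (f n * E + R′) + (a * f n + A′)   ≡⟨ regroup′ y (f n) E R′ a A′ ⟩
  f n * (a + y * E) + (A′ + y * R′)     ∎
  where
  open ≡-Reasoning
  A = applyₚ p f n
  A′ = applyₚ p f (suc n)
  R = evalₚ (remₚ p f n) y
  R′ = evalₚ (remₚ p f (suc n)) y
  E = evalₚ p y
  regroup : ∀ y A R a x A′ → y * (A + y * R) + (a * x + A′) ≡ y * (y * R + A) + (a * x + A′)
  regroup = solve-∀
  regroup′ : ∀ y x E R′ a A′ → y * (x * E + R′) + (a * x + A′) ≡ x * (a + y * E) + (A′ + y * R′)
  regroup′ = solve-∀

remₚ-division : ∀ {p f} → Annihilates p f → ∀ y n →
  Σ ℤ λ q → y ^ℤ n * evalₚ (remₚ p f 0) y ≡ evalₚ p y * q + evalₚ (remₚ p f n) y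
remₚ-division {p} {f} ann y zero = 0ℤ , trans (ℤ.*-identityˡ _)
  (sym (trans (cong (_+ evalₚ (remₚ p f 0) y) (ℤ.*-zeroʳ (evalₚ p y))) (ℤ.+-identityˡ _)))
remₚ-division {p} {f} ann y (suc n) with remₚ-division {p} {f} ann y n
... | q , eq = y * q + f n , (begin
  y * y ^ℤ n * R₀                        ≡⟨ ℤ.*-assoc y (y ^ℤ n) R₀ ⟩
  y * (y ^ℤ n * R₀)                      ≡⟨ cong (y *_) eq ⟩
  y * (P * q + Rₙ)                       ≡⟨ regroup y P q Rₙ ⟩
  P * (y * q) + (y * Rₙ + 0ℤ)            ≡⟨ cong (λ t → P * (y * q) + (y * Rₙ + t)) (sym (ann n)) ⟩
  P * (y * q) + (y * Rₙ + applyₚ p f n)  ≡⟨ cong (P * (y * q) +ℤ_) (remₚ-step p f n y) ⟩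
  P * (y * q) + (f n * P + Rₙ₊₁)         ≡⟨ regroup′ P y q (f n) Rₙ₊₁ ⟩
  P * (y * q + f n) + Rₙ₊₁               ∎)
  where
  open ≡-Reasoning
  P = evalₚ p y
  R₀ = evalₚ (remₚ p f 0) y
  Rₙ = evalₚ (remₚ p f n) y
  Rₙ₊₁ = evalₚ (remₚ p f (suc n)) y
  regroup : ∀ y P q R → y * (P * q + R) ≡ P * (y * q) + (y * R + 0ℤ)
  regroup = solve-∀
  regroup′ : ∀ P y q x R → P * (y * q) + (x * P + R) ≡ P * (y * q + x) + R
  regroup′ = solve-∀

remₚ-top : ∀ N {p} f n → Monic (suc N) p → drop N (remₚ p f n) ≈ₚ f n ∷ []
remₚ-top N {p} f n monic i = begin
  coeff (drop N (remₚ p f n)) i           ≡⟨ coeff-drop N (remₚ p f n) i ⟩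
  coeff (remₚ p f n) (N +ℕ i)             ≡⟨ coeff-remₚ p f n (N +ℕ i) ⟩
  applyₚ (drop (suc N +ℕ i) p) f n        ≡⟨ cong (λ q → applyₚ q f n) (sym (List.drop-drop (suc N) i p)) ⟩
  applyₚ (drop i (drop (suc N) p)) f n    ≡⟨ top i ⟩
  coeff (f n ∷ []) i                      ∎
  where
  open ≡-Reasoning
  top : ∀ i → applyₚ (drop i (drop (suc N) p)) f n ≡ coeff (f n ∷ []) i
  top zero    = trans (applyₚ-cong {drop (suc N) p} f n monic) (trans (ℤ.+-identityʳ _) (ℤ.*-identityˡ _))
  top (suc j) = applyₚ-≈[] {drop (suc j) (drop (suc N) p)} f n (λ k →
    trans (coeff-drop (suc j) (drop (suc N) p) k) (monic (suc (j +ℕ k))))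

-- The polynomials of the theorem

polyU-suc : ∀ k v → polyU (suc k) v ≡ v (suc k) ∷ polyU k v
polyU-suc k v = trans (List.map-upTo _ (suc (suc k))) (cong (v (suc k) ∷_) (sym (List.map-upTo _ (suc k))))

coeff-*ₚ-polyU : ∀ p k v i → coeff (p *ₚ polyU k v) (suc k +ℕ i) ≡ ∑ (suc k) (λ t → coeff p (suc i +ℕ t) * v t)
coeff-*ₚ-polyU p zero v i = begin
  coeff (p *ₚ (v 0 ∷ [])) (suc i)              ≡⟨ coeff-*ₚ-∷ʳ p (v 0) [] (suc i) ⟩
  v 0 * coeff p (suc i) + coeff (p *ₚ []) i    ≡⟨ cong₂ _+_ (ℤ.*-comm (v 0) _) (*ₚ-zeroʳ p i) ⟩
  coeff p (suc i) * v 0 + 0ℤ                   ≡⟨ cong (λ j → coeff p j * v 0 + 0ℤ) (sym (ℕ.+-identityʳ (suc i))) ⟩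
  coeff p (suc i +ℕ 0) * v 0 + 0ℤ              ∎
  where open ≡-Reasoning
coeff-*ₚ-polyU p (suc k) v i = begin
  coeff (p *ₚ polyU (suc k) v) (suc (suc k) +ℕ i)
    ≡⟨ cong (λ U → coeff (p *ₚ U) (suc (suc k) +ℕ i)) (polyU-suc k v) ⟩
  coeff (p *ₚ (v (suc k) ∷ polyU k v)) (suc (suc k) +ℕ i)
    ≡⟨ coeff-*ₚ-∷ʳ p (v (suc k)) (polyU k v) (suc (suc k) +ℕ i) ⟩
  v (suc k) * coeff p (suc (suc k) +ℕ i) + coeff (p *ₚ polyU k v) (suc k +ℕ i)
    ≡⟨ cong₂ _+_ (cong (λ j → v (suc k) * coeff p (suc j)) (ℕ.+-comm (suc k) i)) (coeff-*ₚ-polyU p k v i) ⟩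
  v (suc k) * coeff p (suc i +ℕ suc k) + ∑ (suc k) g
    ≡⟨ trans (ℤ.+-comm (v (suc k) * coeff p (suc i +ℕ suc k)) _) (cong (∑ (suc k) g +ℤ_) (ℤ.*-comm (v (suc k)) _)) ⟩
  ∑ (suc k) g + g (suc k)
    ≡⟨ sym (∑-snoc (suc k) g) ⟩
  ∑ (suc (suc k)) g
    ∎
  where
  open ≡-Reasoning
  g : ℕ → ℤ
  g t = coeff p (suc i +ℕ t) * v t

drop-*ₚ-polyU : ∀ k p v → drop (suc (suc k)) p ≈ₚ [] → drop (suc k) (p *ₚ polyU k v) ≈ₚ remₚ p v 0
drop-*ₚ-polyU k p v deg i = begin
  coeff (drop (suc k) (p *ₚ polyU k v)) i                  ≡⟨ coeff-drop (suc k) (p *ₚ polyU k v) i ⟩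
  coeff (p *ₚ polyU k v) (suc k +ℕ i)                      ≡⟨ coeff-*ₚ-polyU p k v i ⟩
  ∑ (suc k) (λ t → coeff p (suc i +ℕ t) * v t)             ≡⟨ ∑-cong (suc k) (λ t _ → shift t) ⟩
  ∑ (suc k) (λ t → coeff (drop (suc i) p) t * v (t +ℕ 0))  ≡⟨ sym (applyₚ-∑ (suc k) (drop (suc i) p) v 0 tail-deg) ⟩
  applyₚ (drop (suc i) p) v 0                              ≡⟨ sym (coeff-remₚ p v 0 i) ⟩
  coeff (remₚ p v 0) i                                     ∎
  where
  open ≡-Reasoning
  shift : ∀ t → coeff p (suc i +ℕ t) * v t ≡ coeff (drop (suc i) p) t * v (t +ℕ 0)
  shift t = cong₂ _*_ (sym (coeff-drop (suc i) p t)) (cong v (sym (ℕ.+-identityʳ t)))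
  tail-deg : drop (suc k) (drop (suc i) p) ≈ₚ []
  tail-deg j = begin
    coeff (drop (suc k) (drop (suc i) p)) j  ≡⟨ coeff-drop (suc k) (drop (suc i) p) j ⟩
    coeff (drop (suc i) p) (suc k +ℕ j)      ≡⟨ coeff-drop (suc i) p (suc k +ℕ j) ⟩
    coeff p (suc i +ℕ (suc k +ℕ j))          ≡⟨ cong (coeff p) (reassoc i k j) ⟩
    coeff p (suc (suc k) +ℕ (i +ℕ j))        ≡⟨ sym (coeff-drop (suc (suc k)) p (i +ℕ j)) ⟩
    coeff (drop (suc (suc k)) p) (i +ℕ j)    ≡⟨ deg (i +ℕ j) ⟩
    0ℤ                                       ∎
    where
    reassoc : ∀ i k j → suc i +ℕ (suc k +ℕ j) ≡ suc (suc k) +ℕ (i +ℕ j)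
    reassoc = ℕ-Solver.solve-∀

coeff-linear-*ₚ : ∀ r q k → coeff ((r ∷ 1ℤ ∷ []) *ₚ q) (suc k) ≡ r * coeff q (suc k) + coeff q k
coeff-linear-*ₚ r q k = trans (coeff-*ₚ-∷ˡ r (1ℤ ∷ []) q k) (cong (r * coeff q (suc k) +ℤ_) (*ₚ-identityˡ q k))

coeff-applyUpTo : ∀ g N i → i < N → coeff (applyUpTo g N) i ≡ g i
coeff-applyUpTo g (suc N) zero    _         = refl
coeff-applyUpTo g (suc N) (suc i) (s≤s i<N) = coeff-applyUpTo (λ j → g (suc j)) N i i<N

drop-applyUpTo : ∀ (g : ℕ → ℤ) N → drop N (applyUpTo g N) ≡ []
drop-applyUpTo g zero    = refl
drop-applyUpTo g (suc N) = drop-applyUpTo (λ j → g (suc j)) N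

coeff-charPoly : ∀ d α k → k ≤ d → coeff (charPoly d α) k ≡ α' α (d ∸ k)
coeff-charPoly d α k k≤d =
  trans (cong (λ p → coeff p k) (List.map-upTo g (suc d))) (coeff-applyUpTo g (suc d) k (s≤s k≤d))
  where
  g : ℕ → ℤ
  g k = α' α (d ∸ k)

drop-charPoly : ∀ d α → drop (suc d) (charPoly d α) ≡ []
drop-charPoly d α = trans (cong (drop (suc d)) (List.map-upTo g (suc d))) (drop-applyUpTo g (suc d))
  where
  g : ℕ → ℤ
  g k = α' α (d ∸ k)

charPoly-annihilates : ∀ d α s → (∀ n → s (n +ℕ d) + sum1 d (λ i → α i * s (n +ℕ d ∸ i)) ≡ 0ℤ) →
  Annihilates (charPoly d α) s
charPoly-annihilates d α s rec m = begin
  applyₚ (charPoly d α) s m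
    ≡⟨ applyₚ-∑ (suc d) (charPoly d α) s m (λ i → cong (λ p → coeff p i) (drop-charPoly d α)) ⟩
  ∑ (suc d) (λ t → coeff (charPoly d α) t * s (t +ℕ m))
    ≡⟨ ∑-cong (suc d) (λ t t≤d → cong (_* s (t +ℕ m)) (coeff-charPoly d α t (ℕ.≤-pred t≤d))) ⟩
  ∑ (suc d) (λ t → α' α (d ∸ t) * s (t +ℕ m))
    ≡⟨ sym (∑-reverse d (λ t → α' α (d ∸ t) * s (t +ℕ m))) ⟩
  ∑ (suc d) (λ t → α' α (d ∸ (d ∸ t)) * s (d ∸ t +ℕ m))
    ≡⟨ ∑-cong (suc d) (λ t t≤d → reindex t (ℕ.≤-pred t≤d)) ⟩
  1ℤ * s (m +ℕ d) + ∑ d (λ i → α (suc i) * s (m +ℕ d ∸ suc i))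
    ≡⟨ cong₂ _+_ (ℤ.*-identityˡ (s (m +ℕ d))) (sym (sum1≡∑ d (λ i → α i * s (m +ℕ d ∸ i)))) ⟩
  s (m +ℕ d) + sum1 d (λ i → α i * s (m +ℕ d ∸ i))
    ≡⟨ rec m ⟩
  0ℤ
    ∎
  where
  open ≡-Reasoning
  reindex : ∀ t → t ≤ d → α' α (d ∸ (d ∸ t)) * s (d ∸ t +ℕ m) ≡ α' α t * s (m +ℕ d ∸ t)
  reindex t t≤d = cong₂ (λ i j → α' α i * s j) (ℕ.m∸[m∸n]≡n t≤d)
                        (trans (ℕ.+-comm (d ∸ t) m) (sym (ℕ.+-∸-assoc m t≤d)))

polyB-monic : ∀ d α c → Monic (suc d) (polyB d α c)
polyB-monic d α c i = begin
  coeff (drop (suc d) (polyB d α c)) i            ≡⟨ coeff-drop (suc d) (polyB d α c) i ⟩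
  coeff (polyB d α c) (suc (d +ℕ i))              ≡⟨ coeff-linear-*ₚ (- + c) P (d +ℕ i) ⟩
  - + c * coeff P (suc d +ℕ i) + coeff P (d +ℕ i) ≡⟨ cong (λ x → - + c * x + coeff P (d +ℕ i)) (above-degree i) ⟩
  - + c * 0ℤ + coeff P (d +ℕ i)                   ≡⟨ cong (_+ coeff P (d +ℕ i)) (ℤ.*-zeroʳ (- + c)) ⟩
  0ℤ + coeff P (d +ℕ i)                           ≡⟨ ℤ.+-identityˡ _ ⟩
  coeff P (d +ℕ i)                                ≡⟨ top i ⟩
  coeff (1ℤ ∷ []) i                               ∎
  where
  open ≡-Reasoning
  P = charPoly d α
  above-degree : ∀ i → coeff P (suc d +ℕ i) ≡ 0ℤ
  above-degree i = trans (sym (coeff-drop (suc d) P i)) (cong (λ p → coeff p i) (drop-charPoly d α))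
  top : ∀ i → coeff P (d +ℕ i) ≡ coeff (1ℤ ∷ []) i
  top zero    = trans (cong (coeff P) (ℕ.+-identityʳ d))
                      (trans (coeff-charPoly d α d ℕ.≤-refl) (cong (α' α) (ℕ.n∸n≡0 d)))
  top (suc i) = trans (cong (coeff P) (ℕ.+-suc d i)) (above-degree i)

polyB-annihilates : ∀ d α s c → (∀ n → s (n +ℕ d) + sum1 d (λ i → α i * s (n +ℕ d ∸ i)) ≡ 0ℤ) →
  Annihilates (polyB d α c) (λ n → s n + + (c ^ suc n))
polyB-annihilates d α s c rec = annihilates-+ (polyB d α c) {s} {g}
  (annihilates-*ₚ (- + c ∷ 1ℤ ∷ []) {charPoly d α} {s} (charPoly-annihilates d α s rec))
  (λ n → trans (applyₚ-*ₚ (- + c ∷ 1ℤ ∷ []) (charPoly d α) g n)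
               (linear-annihilates-geometric (+ c) (applyₚ-geometric (charPoly d α) (+ c) g-step) n))
  where
  g : ℕ → ℤ
  g n = + (c ^ suc n)
  g-step : ∀ m → g (suc m) ≡ + c * g m
  g-step m = ℤ.pos-* c (c ^ suc m)

-- Estimates

^-positive : ∀ {Y} N → 1 ≤ Y → 1 ≤ Y ^ N
^-positive {Y} N Y≥1 = ℕ.m^n>0 Y {{>-nonZero Y≥1}} N

m≤m*Y^N : ∀ m {Y} N → 1 ≤ Y → m ≤ m *ℕ Y ^ N
m≤m*Y^N m N Y≥1 = ℕ.m≤m*n m _ {{>-nonZero (^-positive N Y≥1)}}

pos-^ : ∀ m n → + (m ^ n) ≡ (+ m) ^ℤ n
pos-^ m zero    = refl
pos-^ m (suc n) = trans (ℤ.pos-* m (m ^ n)) (cong (λ t → + m * t) (pos-^ m n))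

length-take≤ : ∀ N (p : Poly) → length (take N p) ≤ N
length-take≤ N p = ℕ.≤-trans (ℕ.≤-reflexive (List.length-take N p)) (ℕ.m⊓n≤m N (length p))

coeffs-bounded : ∀ p → Σ ℕ λ M → All (λ a → ∣ a ∣ ≤ M) p
coeffs-bounded []      = 0 , []
coeffs-bounded (a ∷ p) with coeffs-bounded p
... | M , bounded = ∣ a ∣ ⊔ M , ℕ.m≤m⊔n ∣ a ∣ M ∷ All.map (λ le → ℕ.≤-trans le (ℕ.m≤n⊔m ∣ a ∣ M)) bounded

evalₚ-bound : ∀ {M Y} N p → 1 ≤ Y → length p ≤ suc N → All (λ a → ∣ a ∣ ≤ M) p →
  ∣ evalₚ p (+ Y) ∣ ≤ suc N *ℕ (M *ℕ Y ^ N)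
evalₚ-bound N       []          _   _         _ = z≤n
evalₚ-bound {M} {Y} zero (a ∷ []) _ _ (a≤M ∷ []) = begin
  ∣ a + + Y * 0ℤ ∣  ≡⟨ cong ∣_∣ (trans (cong (a +ℤ_) (ℤ.*-zeroʳ (+ Y))) (ℤ.+-identityʳ a)) ⟩
  ∣ a ∣             ≤⟨ a≤M ⟩
  M                 ≡⟨ sym (trans (ℕ.*-identityˡ _) (ℕ.*-identityʳ M)) ⟩
  1 *ℕ (M *ℕ 1)     ∎
  where open ℕ.≤-Reasoning
evalₚ-bound zero (a ∷ b ∷ p) _ (s≤s ()) _
evalₚ-bound {M} {Y} (suc N) (a ∷ p) Y≥1 (s≤s len) (a≤M ∷ bounded) = begin
  ∣ a + + Y * evalₚ p (+ Y) ∣                 ≤⟨ ℤ.∣i+j∣≤∣i∣+∣j∣ a _ ⟩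
  ∣ a ∣ +ℕ ∣ + Y * evalₚ p (+ Y) ∣            ≡⟨ cong (∣ a ∣ +ℕ_) (ℤ.abs-* (+ Y) _) ⟩
  ∣ a ∣ +ℕ Y *ℕ ∣ evalₚ p (+ Y) ∣             ≤⟨ ℕ.+-mono-≤ a≤M (ℕ.*-monoʳ-≤ Y (evalₚ-bound N p Y≥1 len bounded)) ⟩
  M +ℕ Y *ℕ (suc N *ℕ (M *ℕ Y ^ N))          ≤⟨ ℕ.+-monoˡ-≤ _ (m≤m*Y^N M (suc N) Y≥1) ⟩
  M *ℕ Y ^ suc N +ℕ Y *ℕ (suc N *ℕ (M *ℕ Y ^ N))  ≡⟨ regroup M Y (Y ^ N) N ⟩
  suc (suc N) *ℕ (M *ℕ Y ^ suc N)            ∎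
  where
  open ℕ.≤-Reasoning
  regroup : ∀ M Y Z N → M *ℕ (Y *ℕ Z) +ℕ Y *ℕ (suc N *ℕ (M *ℕ Z)) ≡ suc (suc N) *ℕ (M *ℕ (Y *ℕ Z))
  regroup = ℕ-Solver.solve-∀

applyₚ-bound : ∀ {M L} p f n → All (λ a → ∣ a ∣ ≤ M) p →
  (∀ t → t < length p → ∣ f (t +ℕ n) ∣ ≤ L) → ∣ applyₚ p f n ∣ ≤ length p *ℕ (M *ℕ L)
applyₚ-bound         []      f n _               _      = z≤n
applyₚ-bound {M} {L} (a ∷ p) f n (a≤M ∷ bounded) window = begin
  ∣ a * f n + applyₚ p f (suc n) ∣           ≤⟨ ℤ.∣i+j∣≤∣i∣+∣j∣ (a * f n) _ ⟩
  ∣ a * f n ∣ +ℕ ∣ applyₚ p f (suc n) ∣      ≡⟨ cong (_+ℕ ∣ applyₚ p f (suc n) ∣) (ℤ.abs-* a (f n)) ⟩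
  ∣ a ∣ *ℕ ∣ f n ∣ +ℕ ∣ applyₚ p f (suc n) ∣ ≤⟨ ℕ.+-mono-≤ (ℕ.*-mono-≤ a≤M (window 0 (s≤s z≤n)))
                                                  (applyₚ-bound p f (suc n) bounded window′) ⟩
  M *ℕ L +ℕ length p *ℕ (M *ℕ L)            ∎
  where
  open ℕ.≤-Reasoning
  window′ : ∀ t → t < length p → ∣ f (t +ℕ suc n) ∣ ≤ L
  window′ t t<p = subst (λ m → ∣ f m ∣ ≤ L) (sym (ℕ.+-suc t n)) (window (suc t) (s≤s t<p))

remₚ-bound : ∀ {M L} p f n → All (λ a → ∣ a ∣ ≤ M) p →
  (∀ t → t < length p → ∣ f (t +ℕ n) ∣ ≤ L) → All (λ r → ∣ r ∣ ≤ length p *ℕ (M *ℕ L)) (remₚ p f n)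
remₚ-bound         []      f n _             _      = []
remₚ-bound {M} {L} (a ∷ p) f n (_ ∷ bounded) window =
  weaken (applyₚ-bound p f n bounded window′) ∷ All.map weaken (remₚ-bound p f n bounded window′)
  where
  window′ : ∀ t → t < length p → ∣ f (t +ℕ n) ∣ ≤ L
  window′ t t<p = window t (ℕ.m<n⇒m<1+n t<p)
  weaken : ∀ {x} → x ≤ length p *ℕ (M *ℕ L) → x ≤ length (a ∷ p) *ℕ (M *ℕ L)
  weaken x≤ = ℕ.≤-trans x≤ (ℕ.m≤n+m _ (M *ℕ L))

small-perturbation : ∀ a k (x : ℤ) → ∣ x ∣ ≤ k → k ≤ a →
  Σ ℕ λ z → (+ a + x ≡ + z) × (a ∸ k ≤ z) × (z ≤ a +ℕ k)
small-perturbation a k (+ m)    m≤k k≤a =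
  a +ℕ m , refl , ℕ.≤-trans (ℕ.m∸n≤m a k) (ℕ.m≤m+n a m) , ℕ.+-monoʳ-≤ a m≤k
small-perturbation a k -[1+ m ] m<k k≤a =
  a ∸ suc m , ℤ.⊖-≥ (ℕ.≤-trans m<k k≤a) , ℕ.∸-monoʳ-≤ a m<k , ℕ.≤-trans (ℕ.m∸n≤m a (suc m)) (ℕ.m≤m+n a k)

multiple-smaller-than-modulus : ∀ j m → ∣ j * + m ∣ < m → j ≡ 0ℤ
multiple-smaller-than-modulus j m small = ℤ.∣i∣≡0⇒i≡0 (ℕ.n<1⇒n≡0 (ℕ.*-cancelʳ-< m ∣ j ∣ 1
  (subst₂ _<_ (ℤ.abs-* j (+ m)) (sym (ℕ.*-identityˡ m)) small)))

modℤ-unique : ∀ m q z → z < suc m → (+ suc m * q + + z) modℤ (+ suc m) ≡ z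
modℤ-unique m q z z<m = sym (ℤ.+-injective (ℤ.i-j≡0⇒i≡j (+ z) (+ r) z-r≡0))
  where
  x = + suc m * q + + z
  r = x ℤ.%ℕ suc m
  q′ = x ℤ./ℕ suc m
  z-r≡[q′-q]m : + z - + r ≡ (q′ - q) * + suc m
  z-r≡[q′-q]m = begin
    + z - + r                         ≡⟨ rearrange (+ suc m) q (+ z) (+ r) ⟩
    x - + suc m * q - + r             ≡⟨ cong (λ t → t - + suc m * q - + r) (ℤ.a≡a%ℕn+[a/ℕn]*n x (suc m)) ⟩
    (+ r + q′ * + suc m) - + suc m * q - + r  ≡⟨ rearrange′ (+ suc m) q (+ r) q′ ⟩
    (q′ - q) * + suc m                ∎
    where
    open ≡-Reasoning
    rearrange : ∀ m q z r → z - r ≡ (m * q + z) - m * q - r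
    rearrange = solve-∀
    rearrange′ : ∀ m q r q′ → (r + q′ * m) - m * q - r ≡ (q′ - q) * m
    rearrange′ = solve-∀
  ∣z-r∣<m : ∣ + z - + r ∣ < suc m
  ∣z-r∣<m = ℕ.≤-<-trans (ℕ.≤-trans (ℕ.≤-reflexive (cong ∣_∣ (ℤ.m-n≡m⊖n z r))) (ℤ.∣m⊝n∣≤m⊔n z r))
                        (ℕ.⊔-pres-<m z<m (ℤ.n%ℕd<d x (suc m)))
  z-r≡0 : + z - + r ≡ 0ℤ
  z-r≡0 = trans z-r≡[q′-q]m (cong (_* + suc m) (multiple-smaller-than-modulus (q′ - q) (suc m)
            (subst (λ t → ∣ t ∣ < suc m) z-r≡[q′-q]m ∣z-r∣<m)))

divℕ-unique : ∀ z m w → w *ℕ m ≤ z → z < suc w *ℕ m → z divℕ m ≡ w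
divℕ-unique z zero    w _  z<0 = ⊥-elim (ℕ.n≮0 (subst (z <_) (ℕ.*-zeroʳ (suc w)) z<0))
divℕ-unique z (suc m) w lo hi = ℕ.≤-antisym (ℕ.<⇒≤pred (ℕ.m<n*o⇒m/o<n hi))
  (ℕ.≤-trans (ℕ.≤-reflexive (sym (ℕ.m*n/n≡m w (suc m)))) (ℕ./-monoˡ-≤ (suc m) lo))

digit-of-remainder : ∀ {Bv Bn z w m} q → Bv ≡ + Bn → z < Bn → w *ℕ m ≤ z → z < suc w *ℕ m →
  (Bv ≢ 0ℤ) × ((Bv * q + + z) modℤ Bv) divℕ m ≡ w
digit-of-remainder {Bn = zero}  q refl () _ _
digit-of-remainder {Bn = suc k} {z} {w} {m} q refl z<Bn lo hi =
  (λ ()) , trans (cong (_divℕ m) (modℤ-unique k q z z<Bn)) (divℕ-unique z m w lo hi)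

remainder-window : ∀ {P Y H k} w E → 1 ≤ P → ∣ E ∣ ≤ P *ℕ k → k ≤ H → H +ℕ k < Y →
  Σ ℕ λ z → (+ (P *ℕ H) + + (P *ℕ Y) * + w + E ≡ + z) × (w *ℕ (P *ℕ Y) ≤ z) × (z < suc w *ℕ (P *ℕ Y))
remainder-window {P} {Y} {H} {k} w E P≥1 E≤Pk k≤H H+k<Y = z , trans (cong (_+ E) leading) z-eq , lower , upper
  where
  a = P *ℕ Y *ℕ w +ℕ P *ℕ H
  Pk≤PH : P *ℕ k ≤ P *ℕ H
  Pk≤PH = ℕ.*-monoʳ-≤ P k≤H
  perturbed = small-perturbation a (P *ℕ k) E E≤Pk (ℕ.≤-trans Pk≤PH (ℕ.m≤n+m _ _))
  z = proj₁ perturbed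
  z-eq = proj₁ (proj₂ perturbed)
  leading : + (P *ℕ H) + + (P *ℕ Y) * + w ≡ + a
  leading = trans (ℤ.+-comm (+ (P *ℕ H)) (+ (P *ℕ Y) * + w))
    (sym (trans (ℤ.pos-+ (P *ℕ Y *ℕ w) (P *ℕ H)) (cong (_+ + (P *ℕ H)) (ℤ.pos-* (P *ℕ Y) w))))
  lower : w *ℕ (P *ℕ Y) ≤ z
  lower = begin
    w *ℕ (P *ℕ Y)                   ≡⟨ ℕ.*-comm w (P *ℕ Y) ⟩
    P *ℕ Y *ℕ w                     ≤⟨ ℕ.m≤m+n _ _ ⟩
    P *ℕ Y *ℕ w +ℕ (P *ℕ H ∸ P *ℕ k) ≡⟨ sym (ℕ.+-∸-assoc (P *ℕ Y *ℕ w) Pk≤PH) ⟩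
    a ∸ P *ℕ k                      ≤⟨ proj₁ (proj₂ (proj₂ perturbed)) ⟩
    z                               ∎
    where open ℕ.≤-Reasoning
  upper : z < suc w *ℕ (P *ℕ Y)
  upper = begin-strict
    z                                ≤⟨ proj₂ (proj₂ (proj₂ perturbed)) ⟩
    a +ℕ P *ℕ k                      ≡⟨ regroup P Y H k w ⟩
    P *ℕ Y *ℕ w +ℕ P *ℕ (H +ℕ k)     <⟨ ℕ.+-monoʳ-< (P *ℕ Y *ℕ w) (ℕ.*-monoʳ-< P {{>-nonZero P≥1}} H+k<Y) ⟩
    P *ℕ Y *ℕ w +ℕ P *ℕ Y            ≡⟨ ℕ.+-comm (P *ℕ Y *ℕ w) _ ⟩
    P *ℕ Y +ℕ P *ℕ Y *ℕ w            ≡⟨ cong (P *ℕ Y +ℕ_) (ℕ.*-comm (P *ℕ Y) w) ⟩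
    suc w *ℕ (P *ℕ Y)                ∎
    where
    open ℕ.≤-Reasoning
    regroup : ∀ P Y H k w → P *ℕ Y *ℕ w +ℕ P *ℕ H +ℕ P *ℕ k ≡ P *ℕ Y *ℕ w +ℕ P *ℕ (H +ℕ k)
    regroup = ℕ-Solver.solve-∀

monic-value-bound : ∀ {P Y D} F → ∣ F ∣ ≤ D *ℕ (P *ℕ Y) → D ≤ Y →
  Σ ℕ λ Bn → (+ (P *ℕ Y *ℕ Y) + F ≡ + Bn) × ((Y ∸ D) *ℕ (P *ℕ Y) ≤ Bn)
monic-value-bound {P} {Y} {D} F F≤ D≤Y = Bn , proj₁ (proj₂ perturbed) , lower
  where
  DPY≤PYY : D *ℕ (P *ℕ Y) ≤ P *ℕ Y *ℕ Y
  DPY≤PYY = ℕ.≤-trans (ℕ.*-monoˡ-≤ (P *ℕ Y) D≤Y) (ℕ.≤-reflexive (ℕ.*-comm Y (P *ℕ Y)))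
  perturbed = small-perturbation (P *ℕ Y *ℕ Y) (D *ℕ (P *ℕ Y)) F F≤ DPY≤PYY
  Bn = proj₁ perturbed
  lower : (Y ∸ D) *ℕ (P *ℕ Y) ≤ Bn
  lower = ℕ.≤-trans (ℕ.≤-reflexive (trans (ℕ.*-distribʳ-∸ (P *ℕ Y) Y D) (cong (_∸ D *ℕ (P *ℕ Y)) (ℕ.*-comm Y (P *ℕ Y)))))
                    (proj₁ (proj₂ (proj₂ perturbed)))

-- With P = Y^(d-1), the residue P H + Y^d w + E of x lies in [w Y^d, (w + 1) Y^d) ⊆ [0, Bv).
digit-extraction : ∀ {P Y H k D w W} {Bv F E} q → 1 ≤ P →
  Bv ≡ + (P *ℕ Y *ℕ Y) + F → ∣ F ∣ ≤ D *ℕ (P *ℕ Y) →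
  ∣ E ∣ ≤ P *ℕ k → k ≤ H → H +ℕ k < Y → w ≤ W → W +ℕ D < Y →
  (Bv ≢ 0ℤ) × ((Bv * q + (+ (P *ℕ H) + + (P *ℕ Y) * + w + E)) modℤ Bv) divℕ (P *ℕ Y) ≡ w
digit-extraction {P} {Y} {H} {k} {D} {w} {W} {Bv} {F} {E} q P≥1 Bv≡ F≤ E≤ k≤H H+k<Y w≤W W+D<Y =
  subst (λ t → (Bv ≢ 0ℤ) × ((Bv * q + t) modℤ Bv) divℕ (P *ℕ Y) ≡ w) (sym z-eq)
        (digit-of-remainder q (trans Bv≡ Bn-eq) z<Bn z-lower z-upper)
  where
  window = remainder-window w E P≥1 E≤ k≤H H+k<Y
  z = proj₁ window
  z-eq = proj₁ (proj₂ window)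
  z-lower = proj₁ (proj₂ (proj₂ window))
  z-upper = proj₂ (proj₂ (proj₂ window))
  D≤Y : D ≤ Y
  D≤Y = ℕ.≤-trans (ℕ.m≤n+m D W) (ℕ.<⇒≤ W+D<Y)
  value = monic-value-bound {P} F F≤ D≤Y
  Bn = proj₁ value
  Bn-eq = proj₁ (proj₂ value)
  z<Bn : z < Bn
  z<Bn = begin-strict
    z                    <⟨ z-upper ⟩
    suc w *ℕ (P *ℕ Y)    ≤⟨ ℕ.*-monoˡ-≤ (P *ℕ Y) (ℕ.m+n≤o⇒m≤o∸n (suc w) (ℕ.≤-trans (ℕ.+-monoˡ-≤ D (s≤s w≤W)) W+D<Y)) ⟩
    (Y ∸ D) *ℕ (P *ℕ Y)  ≤⟨ proj₂ (proj₂ value) ⟩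
    Bn                   ∎
    where open ℕ.≤-Reasoning

*-^-≤ : ∀ {G x b} h → G *ℕ x ≤ b → x ≤ b → G *ℕ x ^ suc h ≤ b ^ suc h
*-^-≤ {G} {x} {b} zero    Gx≤b x≤b = subst₂ _≤_ (cong (G *ℕ_) (sym (ℕ.*-identityʳ x))) (sym (ℕ.*-identityʳ b)) Gx≤b
*-^-≤ {G} {x} {b} (suc h) Gx≤b x≤b = begin
  G *ℕ (x *ℕ x ^ suc h)  ≡⟨ left-comm G x (x ^ suc h) ⟩
  x *ℕ (G *ℕ x ^ suc h)  ≤⟨ ℕ.*-mono-≤ x≤b (*-^-≤ {G} h Gx≤b x≤b) ⟩
  b *ℕ b ^ suc h         ∎
  where
  open ℕ.≤-Reasoning
  left-comm : ∀ G x y → G *ℕ (x *ℕ y) ≡ x *ℕ (G *ℕ y)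
  left-comm = ℕ-Solver.solve-∀

n≤2⌈n/2⌉ : ∀ n → n ≤ 2 *ℕ ⌈ n /2⌉
n≤2⌈n/2⌉ n = begin
  n                         ≡⟨ sym (ℕ.⌊n/2⌋+⌈n/2⌉≡n n) ⟩
  ⌊ n /2⌋ +ℕ ⌈ n /2⌉      ≤⟨ ℕ.+-monoˡ-≤ ⌈ n /2⌉ (ℕ.⌊n/2⌋≤⌈n/2⌉ n) ⟩
  ⌈ n /2⌉ +ℕ ⌈ n /2⌉        ≡⟨ cong (⌈ n /2⌉ +ℕ_) (sym (ℕ.+-identityʳ ⌈ n /2⌉)) ⟩
  2 *ℕ ⌈ n /2⌉              ∎
  where open ℕ.≤-Reasoning

⌈n/2⌉<n : ∀ n → 2 ≤ n → ⌈ n /2⌉ < n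
⌈n/2⌉<n n@(suc (suc m)) (s≤s (s≤s z≤n)) = subst (suc ⌈ n /2⌉ ≤_) (ℕ.⌊n/2⌋+⌈n/2⌉≡n n) (ℕ.+-monoˡ-≤ ⌈ n /2⌉ (s≤s z≤n))

growth : ∀ {G c b} n → 1 ≤ n → 1 ≤ c → G *ℕ c ^ 2 ≤ b → c ^ 2 ≤ b → G *ℕ c ^ n ≤ b ^ ⌈ n /2⌉
growth {G} {c} {b} n@(suc m) _ c≥1 Gc²≤b c²≤b = begin
  G *ℕ c ^ n                ≤⟨ ℕ.*-monoʳ-≤ G (ℕ.^-monoʳ-≤ c {{>-nonZero c≥1}} (n≤2⌈n/2⌉ n)) ⟩
  G *ℕ c ^ (2 *ℕ ⌈ n /2⌉)   ≡⟨ cong (G *ℕ_) (sym (ℕ.^-*-assoc c 2 ⌈ n /2⌉)) ⟩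
  G *ℕ (c ^ 2) ^ ⌈ n /2⌉    ≤⟨ *-^-≤ {G} ⌊ m /2⌋ Gc²≤b c²≤b ⟩
  b ^ ⌈ n /2⌉               ∎
  where open ℕ.≤-Reasoning

double-half-power< : ∀ {b} n → 3 ≤ b → 2 ≤ n → b ^ ⌈ n /2⌉ +ℕ b ^ ⌈ n /2⌉ < b ^ n
double-half-power< {b} n b≥3 n≥2 = begin-strict
  H +ℕ H              <⟨ ℕ.+-monoʳ-< H (ℕ.m<m+n H (^-positive ⌈ n /2⌉ b≥1)) ⟩
  H +ℕ (H +ℕ H)       ≡⟨ cong (λ t → H +ℕ (H +ℕ t)) (sym (ℕ.+-identityʳ H)) ⟩
  3 *ℕ H              ≤⟨ ℕ.*-monoˡ-≤ H b≥3 ⟩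
  b ^ suc ⌈ n /2⌉     ≤⟨ ℕ.^-monoʳ-≤ b {{>-nonZero b≥1}} (⌈n/2⌉<n n n≥2) ⟩
  b ^ n               ∎
  where
  open ℕ.≤-Reasoning
  H = b ^ ⌈ n /2⌉
  b≥1 : 1 ≤ b
  b≥1 = ℕ.≤-trans (s≤s z≤n) b≥3

module Expansion (d′ : ℕ) (α : ℕ → ℤ) (s : ℕ → ℤ) (c′ : ℕ)
  (rec : ∀ n → s (n +ℕ suc d′) + sum1 (suc d′) (λ i → α i * s (n +ℕ suc d′ ∸ i)) ≡ 0ℤ)
  (s-bound : ∀ n → ∣ s n ∣ < suc c′ ^ suc n) where

  d : ℕ
  d = suc d′

  c : ℕ
  c = suc c′

  u : ℕ → ℤ
  u n = s n + + (c ^ suc n)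

  B : Poly
  B = polyB d α c

  B-monic : Monic (suc d) B
  B-monic = polyB-monic d α c

  u-nat : ∀ n → Σ ℕ λ w → (u n ≡ + w) × (w ≤ c ^ suc n +ℕ c ^ suc n)
  u-nat n =
    let (w , eq , _ , w≤) = small-perturbation (c ^ suc n) (c ^ suc n) (s n) (ℕ.<⇒≤ (s-bound n)) ℕ.≤-refl
    in w , trans (ℤ.+-comm (s n) _) eq , w≤

  ℓ : ℕ
  ℓ = length B

  M : ℕ
  M = proj₁ (coeffs-bounded B)

  u-window : ∀ n t → t < ℓ → ∣ u (t +ℕ n) ∣ ≤ (c ^ ℓ +ℕ c ^ ℓ) *ℕ c ^ n
  u-window n t t<ℓ =
    let (w , u≡w , w≤) = u-nat (t +ℕ n)
        power≤ : c ^ suc (t +ℕ n) ≤ c ^ ℓ *ℕ c ^ n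
        power≤ = ℕ.≤-trans (ℕ.≤-reflexive (ℕ.^-distribˡ-+-* c (suc t) n)) (ℕ.*-monoˡ-≤ (c ^ n) (ℕ.^-monoʳ-≤ c t<ℓ))
    in begin
    ∣ u (t +ℕ n) ∣                            ≡⟨ cong ∣_∣ u≡w ⟩
    w                                         ≤⟨ w≤ ⟩
    c ^ suc (t +ℕ n) +ℕ c ^ suc (t +ℕ n)      ≤⟨ ℕ.+-mono-≤ power≤ power≤ ⟩
    c ^ ℓ *ℕ c ^ n +ℕ c ^ ℓ *ℕ c ^ n          ≡⟨ sym (ℕ.*-distribʳ-+ (c ^ n) (c ^ ℓ) (c ^ ℓ)) ⟩
    (c ^ ℓ +ℕ c ^ ℓ) *ℕ c ^ n                 ∎
    where open ℕ.≤-Reasoning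

  K : ℕ
  K = ℓ *ℕ (M *ℕ (c ^ ℓ +ℕ c ^ ℓ))

  remₚ-coeff-bound : ∀ n → All (λ r → ∣ r ∣ ≤ K *ℕ c ^ n) (remₚ B u n)
  remₚ-coeff-bound n = All.map (λ le → ℕ.≤-trans le (ℕ.≤-reflexive (reassoc ℓ M (c ^ ℓ +ℕ c ^ ℓ) (c ^ n))))
                               (remₚ-bound B u n (proj₂ (coeffs-bounded B)) (u-window n))
    where
    reassoc : ∀ ℓ M C x → ℓ *ℕ (M *ℕ (C *ℕ x)) ≡ ℓ *ℕ (M *ℕ C) *ℕ x
    reassoc = ℕ-Solver.solve-∀

  F : ℕ → ℤ
  F Y = evalₚ (take (suc d) B) (+ Y)

  E : ℕ → ℕ → ℤ
  E Y n = evalₚ (take d (remₚ B u n)) (+ Y)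

  D : ℕ
  D = suc d *ℕ M

  B-value : ∀ Y → evalₚ B (+ Y) ≡ + (Y ^ d′ *ℕ Y *ℕ Y) + F Y
  B-value Y = begin
    evalₚ B (+ Y)               ≡⟨ evalₚ-monic (suc d) {B} (+ Y) B-monic ⟩
    F Y + (+ Y) ^ℤ suc d        ≡⟨ ℤ.+-comm (F Y) _ ⟩
    (+ Y) ^ℤ suc d + F Y        ≡⟨ cong (_+ F Y) (trans (sym (pos-^ Y (suc d))) (cong +_ (reorder Y (Y ^ d′)))) ⟩
    + (Y ^ d′ *ℕ Y *ℕ Y) + F Y  ∎
    where
    open ≡-Reasoning
    reorder : ∀ Y Z → Y *ℕ (Y *ℕ Z) ≡ Z *ℕ Y *ℕ Y
    reorder = ℕ-Solver.solve-∀

  F-bound : ∀ Y → 1 ≤ Y → ∣ F Y ∣ ≤ D *ℕ (Y ^ d′ *ℕ Y)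
  F-bound Y Y≥1 = ℕ.≤-trans
    (evalₚ-bound d (take (suc d) B) Y≥1 (length-take≤ (suc d) B) (All.take⁺ (suc d) (proj₂ (coeffs-bounded B))))
    (ℕ.≤-reflexive (reorder (suc d) M Y (Y ^ d′)))
    where
    reorder : ∀ d M Y Z → d *ℕ (M *ℕ (Y *ℕ Z)) ≡ d *ℕ M *ℕ (Z *ℕ Y)
    reorder = ℕ-Solver.solve-∀

  E-bound : ∀ Y n → 1 ≤ Y → ∣ E Y n ∣ ≤ Y ^ d′ *ℕ (d *ℕ K *ℕ c ^ n)
  E-bound Y n Y≥1 = ℕ.≤-trans
    (evalₚ-bound d′ (take d (remₚ B u n)) Y≥1
      (length-take≤ d (remₚ B u n))
      (All.take⁺ d (remₚ-coeff-bound n)))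
    (ℕ.≤-reflexive (reorder d K (c ^ n) (Y ^ d′)))
    where
    reorder : ∀ d K C Z → d *ℕ (K *ℕ C *ℕ Z) ≡ Z *ℕ (d *ℕ K *ℕ C)
    reorder = ℕ-Solver.solve-∀

  x : ℕ → ℕ → ℤ
  x b n = + (b ^ (n *ℕ d′ +ℕ ⌈ n /2⌉)) + + (b ^ (n *ℕ n)) * evalₚ (polyA d α c u) (+ (b ^ n))

  x-decomposition : ∀ b n → let Y = b ^ n; P = Y ^ d′ in Σ ℤ λ q →
    x b n ≡ evalₚ B (+ Y) * q + (+ (P *ℕ b ^ ⌈ n /2⌉) + + (P *ℕ Y) * u n + E Y n)
  x-decomposition b n = q , (begin
    + (b ^ (n *ℕ d′ +ℕ ⌈ n /2⌉)) + + (b ^ (n *ℕ n)) * evalₚ A y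
      ≡⟨ cong₂ (λ t r → + t + r * evalₚ A y) powers (trans (cong +_ (sym (ℕ.^-*-assoc b n n))) (pos-^ Y n)) ⟩
    + (P *ℕ H) + y ^ℤ n * evalₚ A y
      ≡⟨ cong (λ t → + (P *ℕ H) + y ^ℤ n * t) (evalₚ-cong {A} y (drop-*ₚ-polyU d B u (monic-degree (suc d) {B} B-monic))) ⟩
    + (P *ℕ H) + y ^ℤ n * evalₚ (remₚ B u 0) y
      ≡⟨ cong (+ (P *ℕ H) +ℤ_) (proj₂ division) ⟩
    + (P *ℕ H) + (evalₚ B y * q + evalₚ (remₚ B u n) y)
      ≡⟨ cong (λ t → + (P *ℕ H) + (evalₚ B y * q + t)) (evalₚ-top d {remₚ B u n} y (remₚ-top d {B} u n B-monic)) ⟩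
    + (P *ℕ H) + (evalₚ B y * q + (E Y n + y ^ℤ d * u n))
      ≡⟨ cong (λ t → + (P *ℕ H) + (evalₚ B y * q + (E Y n + t * u n))) (trans (sym (pos-^ Y d)) (cong +_ (ℕ.*-comm Y P))) ⟩
    + (P *ℕ H) + (evalₚ B y * q + (E Y n + + (P *ℕ Y) * u n))
      ≡⟨ regroup (+ (P *ℕ H)) (evalₚ B y * q) (E Y n) (+ (P *ℕ Y) * u n) ⟩
    evalₚ B y * q + (+ (P *ℕ H) + + (P *ℕ Y) * u n + E Y n)
      ∎)
    where
    open ≡-Reasoning
    A = polyA d α c u
    Y = b ^ n
    y = + Y
    P = Y ^ d′
    H = b ^ ⌈ n /2⌉
    division = remₚ-division {B} {u} (polyB-annihilates d α s c rec) y n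
    q = proj₁ division
    powers : b ^ (n *ℕ d′ +ℕ ⌈ n /2⌉) ≡ P *ℕ H
    powers = trans (ℕ.^-distribˡ-+-* b (n *ℕ d′) ⌈ n /2⌉) (cong (_*ℕ H) (sym (ℕ.^-*-assoc b n d′)))
    regroup : ∀ h v e t → h + (v + (e + t)) ≡ v + (h + t + e)
    regroup = solve-∀

  -- G c^n ≤ b^⌈n/2⌉ pays for d K c^n, for (c + c + D) c^n ≥ 2 c^(n+1) + D, and b ≥ G ≥ 3.
  G : ℕ
  G = 3 +ℕ (d *ℕ K +ℕ (c +ℕ c +ℕ D))

  b₀ : ℕ
  b₀ = G *ℕ c ^ 2

  G≤b₀ : G ≤ b₀
  G≤b₀ = m≤m*Y^N G {c} 2 (s≤s z≤n)

  room : ∀ b n → b₀ ≤ b → 2 ≤ n → let H = b ^ ⌈ n /2⌉; k = d *ℕ K *ℕ c ^ n in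
    (k ≤ H) × (H +ℕ k < b ^ n) × (c ^ suc n +ℕ c ^ suc n +ℕ D < b ^ n)
  room b n b₀≤b n≥2 = k≤H , ℕ.≤-<-trans (ℕ.+-monoʳ-≤ H k≤H) H+H<Y , ℕ.≤-<-trans W+D≤H H<Y
    where
    H = b ^ ⌈ n /2⌉
    c≥1 : 1 ≤ c
    c≥1 = s≤s z≤n
    Gc²≤b : G *ℕ c ^ 2 ≤ b
    Gc²≤b = b₀≤b
    G≤b : G ≤ b
    G≤b = ℕ.≤-trans G≤b₀ b₀≤b
    GcⁿH : G *ℕ c ^ n ≤ H
    GcⁿH = growth {G} n (ℕ.≤-trans (s≤s z≤n) n≥2) c≥1 Gc²≤b (ℕ.≤-trans (ℕ.m≤n*m (c ^ 2) G) Gc²≤b)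
    H+H<Y : H +ℕ H < b ^ n
    H+H<Y = double-half-power< n (ℕ.≤-trans (ℕ.m≤m+n 3 _) G≤b) n≥2
    H<Y : H < b ^ n
    H<Y = ℕ.≤-<-trans (ℕ.m≤m+n H H) H+H<Y
    k≤H : d *ℕ K *ℕ c ^ n ≤ H
    k≤H = ℕ.≤-trans (ℕ.*-monoˡ-≤ (c ^ n) (ℕ.≤-trans (ℕ.m≤m+n (d *ℕ K) _) (ℕ.m≤n+m _ 3))) GcⁿH
    W+D≤H : c ^ suc n +ℕ c ^ suc n +ℕ D ≤ H
    W+D≤H = begin
      c ^ suc n +ℕ c ^ suc n +ℕ D              ≤⟨ ℕ.+-monoʳ-≤ (c ^ suc n +ℕ c ^ suc n) (m≤m*Y^N D n c≥1) ⟩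
      c ^ suc n +ℕ c ^ suc n +ℕ D *ℕ c ^ n     ≡⟨ factor c (c ^ n) D ⟩
      (c +ℕ c +ℕ D) *ℕ c ^ n                   ≤⟨ ℕ.*-monoˡ-≤ (c ^ n) (ℕ.≤-trans (ℕ.m≤n+m _ (d *ℕ K)) (ℕ.m≤n+m _ 3)) ⟩
      G *ℕ c ^ n                               ≤⟨ GcⁿH ⟩
      H                                        ∎
      where
      open ℕ.≤-Reasoning
      factor : ∀ c x D → c *ℕ x +ℕ c *ℕ x +ℕ D *ℕ x ≡ (c +ℕ c +ℕ D) *ℕ x
      factor = ℕ-Solver.solve-∀

  expansion : ∀ b → b₀ ≤ b → ∀ n → 2 ≤ n →
    (evalₚ B (+ (b ^ n)) ≢ 0ℤ) ×
    (s n ≡ + ((x b n modℤ evalₚ B (+ (b ^ n))) divℕ (b ^ (n *ℕ d))) - + (c ^ suc n))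
  expansion b b₀≤b n n≥2 =
    let (w , u≡w , w≤W) = u-nat n
        (q , x≡) = x-decomposition b n
        (k≤H , H+k<Y , W+D<Y) = room b n b₀≤b n≥2
        (Bv≢0 , digit) = digit-extraction {F = F Y} {E = E Y n} q (^-positive {Y} d′ Y≥1)
                           (B-value Y) (F-bound Y Y≥1) (E-bound Y n Y≥1) k≤H H+k<Y w≤W W+D<Y
    in Bv≢0 , (begin
    s n                                                      ≡⟨ shift (s n) (+ C) ⟩
    u n - + C                                                ≡⟨ cong (_- + C) u≡w ⟩
    + w - + C                                                ≡⟨ cong (λ t → + t - + C) (sym digit) ⟩
    + (((Bv * q + (+ (P *ℕ H) + + (P *ℕ Y) * + w + E Y n)) modℤ Bv) divℕ (P *ℕ Y)) - + C
      ≡⟨ cong₂ (λ t m → + ((t modℤ Bv) divℕ m) - + C)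
               (sym (trans x≡ (cong (λ t → Bv * q + (+ (P *ℕ H) + + (P *ℕ Y) * t + E Y n)) u≡w)))
               (trans (ℕ.*-comm P Y) (ℕ.^-*-assoc b n d)) ⟩
    + ((x b n modℤ Bv) divℕ (b ^ (n *ℕ d))) - + C            ∎)
    where
    open ≡-Reasoning
    C = c ^ suc n
    Y = b ^ n
    P = Y ^ d′
    H = b ^ ⌈ n /2⌉
    Bv = evalₚ B (+ Y)
    Y≥1 : 1 ≤ Y
    Y≥1 = ^-positive {b} n (ℕ.≤-trans (s≤s z≤n) (ℕ.≤-trans G≤b₀ b₀≤b))
    shift : ∀ a b → a ≡ (a + b) - b
    shift = solve-∀

corollary1 : (d : ℕ) → 2 ≤ d → (α : ℕ → ℤ) → α d ≢ 0ℤ →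
    (s : ℕ → ℤ) →
    (∀ n → s (n +ℕ d) + sum1 d (λ i → α i * s (n +ℕ d ∸ i)) ≡ 0ℤ) →
    (c : ℕ) → 1 ≤ c → (∀ n → ∣ s n ∣ < c ^ suc n) →
    let u : ℕ → ℤ
        u n = s n + + (c ^ suc n)
        B = polyB d α c
        A = polyA d α c u
        x : ℕ → ℕ → ℤ
        x b n = + (b ^ (n *ℕ (d ∸ 1) +ℕ ⌈ n /2⌉)) + + (b ^ (n *ℕ n)) * evalₚ A (+ (b ^ n))
    in Σ ℕ λ n₀ → Σ ℕ λ b₀ → ∀ b → b₀ ≤ b → ∀ n → n₀ ≤ n →
      (evalₚ B (+ (b ^ n)) ≢ 0ℤ) ×
      (s n ≡ + ((x b n modℤ evalₚ B (+ (b ^ n))) divℕ (b ^ (n *ℕ d))) - + (c ^ suc n))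
corollary1 (suc d′) _ α _ s rec (suc c′) _ s-bound = 2 , b₀ , expansion
  where open Expansion d′ α s c′ rec s-bound
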